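{- Let $n$ be an odd positive integer with $s(n)=k\ge4$ and $s(n^2)=4$, and write $n=1+2^\ell m$ with $\ell\ge2$ and $m$ an odd integer. Then $\ell\le 2k$.
   Context: $s(n)$ is the sum of binary digits of $n$. -}

module Defs where

open import Data.Nat using (ℕ; zero; suc; _+_; _%_; _/_)

-- Sum of binary digits, computed with a fuel parameter (fuel ≥ n suffices,
-- since n / 2 < n for n > 0).
s-aux : ℕ → ℕ → ℕ
s-aux zero    n = 0
s-aux (suc f) zero = 0
s-aux (suc f) n@(suc _) = n % 2 + s-aux f (n / 2)

s : ℕ → ℕ
s n = s-aux n n

-- Write n = 1 + 2^ℓ M with M odd and ℓ = 2 + i. Then s n = 1 + s M and n² = 1 + 2^(ℓ+1) A with
-- A = M + 2^(ℓ-1) M², so s A = 3. Splitting M = L + 2^(ℓ-1) t with L < 2^(ℓ-1) odd gives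
-- A = L + 2^(ℓ-1) D with D = t + M², hence s L + s D = 3: either L = 1 and s D = 2, or
-- L = 1 + 2^(e+1) and s D = 1. The bound comes from counting carries: if 2^K divides x + y + 1
-- then K ≤ s x + s y. As D ≡ t + L² (mod 2^ℓ), this gives ℓ ≤ s t + 2 whenever 2^ℓ divides D.
-- Otherwise D = 2^u + 2^v with 0 < u < ℓ; then t + 1 = 2^u + 2^ℓ w, and the high part of D
-- yields 2^(ℓ-2) ∣ w + t, so ℓ - 2 ≤ s w + s t - 1 < 2 s t.

module Submission where

open import Defs
open import Data.Nat using (ℕ; zero; suc; _+_; _*_; _^_; _≤_; _<_; _≥_; z≤n; s≤s; _%_; _/_; NonZero; _≤?_)
open import Data.Nat.Properties
open import Data.Nat.DivMod
open import Data.Nat.Divisibility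
open import Data.Nat.Induction using (<-rec)
open import Data.Product using (∃-syntax; _×_; _,_; proj₁; proj₂)
open import Data.Empty using (⊥-elim)
open import Relation.Nullary using (¬_; yes; no)
open import Relation.Binary.PropositionalEquality
open import Data.Nat.Solver using (module +-*-Solver)
open +-*-Solver

data Binary : ℕ → Set where
  even : ∀ x → Binary (2 * x)
  odd  : ∀ x → Binary (1 + 2 * x)

binary : ∀ n → Binary n
binary zero = even 0
binary (suc n) with binary n
... | even x = odd x
... | odd x = subst Binary (cong suc (+-suc x (x + 0))) (even (suc x))

binary-induction : (P : ℕ → Set) → P 0 →
  (∀ x → P (suc x) → P (2 * suc x)) → (∀ x → P x → P (1 + 2 * x)) → ∀ n → P n
binary-induction P P0 Peven Podd = <-rec P step
  where
  step : ∀ n → (∀ {m} → m < n → P m) → P n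
  step n rec with binary n
  ... | even zero    = P0
  ... | even (suc x) = Peven x (rec (m<m+n (suc x) (s≤s z≤n)))
  ... | odd x        = Podd x (rec (s≤s (m≤m+n x (x + 0))))

s-aux-fuel : ∀ {f g n} → n ≤ f → n ≤ g → s-aux f n ≡ s-aux g n
s-aux-fuel {zero}  {zero}  {zero} _ _ = refl
s-aux-fuel {zero}  {suc g} {zero} _ _ = refl
s-aux-fuel {suc f} {zero}  {zero} _ _ = refl
s-aux-fuel {suc f} {suc g} {zero} _ _ = refl
s-aux-fuel {suc f} {suc g} {suc n} (s≤s n≤f) (s≤s n≤g) =
  cong (suc n % 2 +_) (s-aux-fuel (≤-trans half≤n n≤f) (≤-trans half≤n n≤g))
  where
  half≤n : suc n / 2 ≤ n
  half≤n = ≤-pred (m/n<m (suc n) 2 ≤-refl)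

s≡%2+s[/2] : ∀ n → s n ≡ n % 2 + s (n / 2)
s≡%2+s[/2] zero    = refl
s≡%2+s[/2] (suc n) = cong (suc n % 2 +_) (s-aux-fuel (≤-pred (m/n<m (suc n) 2 ≤-refl)) ≤-refl)

s[2*x]≡s[x] : ∀ x → s (2 * x) ≡ s x
s[2*x]≡s[x] x = begin
  s (2 * x)                     ≡⟨ s≡%2+s[/2] (2 * x) ⟩
  (2 * x) % 2 + s ((2 * x) / 2) ≡⟨ cong₂ (λ r q → r + s q) (trans (cong (_% 2) 2x≡x*2) (m*n%n≡0 x 2))
                                                            (trans (cong (_/ 2) 2x≡x*2) (m*n/n≡m x 2)) ⟩
  s x                           ∎
  where
  open ≡-Reasoning
  2x≡x*2 : 2 * x ≡ x * 2
  2x≡x*2 = *-comm 2 x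

s[1+2*x]≡1+s[x] : ∀ x → s (1 + 2 * x) ≡ 1 + s x
s[1+2*x]≡1+s[x] x = begin
  s (1 + 2 * x)                         ≡⟨ s≡%2+s[/2] (1 + 2 * x) ⟩
  (1 + 2 * x) % 2 + s ((1 + 2 * x) / 2) ≡⟨ cong₂ (λ r q → r + s q) (trans (cong (_% 2) 1+2x≡1+x*2) ([m+kn]%n≡m%n 1 x 2))
                                                                    (trans (cong (_/ 2) 1+2x≡1+x*2) half) ⟩
  1 + s x                               ∎
  where
  open ≡-Reasoning
  1+2x≡1+x*2 : 1 + 2 * x ≡ 1 + x * 2
  1+2x≡1+x*2 = cong (1 +_) (*-comm 2 x)
  half : (1 + x * 2) / 2 ≡ x
  half = trans (+-distrib-/-∣ʳ 1 {d = 2} (n∣m*n x)) (m*n/n≡m x 2)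

s[2^e*x]≡s[x] : ∀ e x → s (2 ^ e * x) ≡ s x
s[2^e*x]≡s[x] zero    x = cong s (+-identityʳ x)
s[2^e*x]≡s[x] (suc e) x = begin
  s (2 * 2 ^ e * x)   ≡⟨ cong s (*-assoc 2 (2 ^ e) x) ⟩
  s (2 * (2 ^ e * x)) ≡⟨ s[2*x]≡s[x] (2 ^ e * x) ⟩
  s (2 ^ e * x)       ≡⟨ s[2^e*x]≡s[x] e x ⟩
  s x                 ∎
  where open ≡-Reasoning

s[2^e]≡1 : ∀ e → s (2 ^ e) ≡ 1
s[2^e]≡1 e = trans (cong s (sym (*-identityʳ (2 ^ e)))) (s[2^e*x]≡s[x] e 1)

s[1+2^[1+e]*x]≡1+s[x] : ∀ e x → s (1 + 2 ^ suc e * x) ≡ 1 + s x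
s[1+2^[1+e]*x]≡1+s[x] e x = begin
  s (1 + 2 * 2 ^ e * x)   ≡⟨ cong (λ y → s (1 + y)) (*-assoc 2 (2 ^ e) x) ⟩
  s (1 + 2 * (2 ^ e * x)) ≡⟨ s[1+2*x]≡1+s[x] (2 ^ e * x) ⟩
  1 + s (2 ^ e * x)       ≡⟨ cong suc (s[2^e*x]≡s[x] e x) ⟩
  1 + s x                 ∎
  where open ≡-Reasoning

s[x+2^e*y]≡s[x]+s[y] : ∀ e x y → x < 2 ^ e → s (x + 2 ^ e * y) ≡ s x + s y
s[x+2^e*y]≡s[x]+s[y] zero zero y _ = cong s (+-identityʳ y)
s[x+2^e*y]≡s[x]+s[y] zero (suc x) y (s≤s ())
s[x+2^e*y]≡s[x]+s[y] (suc e) x y x<2^e with binary x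
... | even x′ = begin
  s (2 * x′ + 2 * 2 ^ e * y)
    ≡⟨ cong s (solve 3 (λ a b c → con 2 :* a :+ con 2 :* b :* c := con 2 :* (a :+ b :* c)) refl x′ (2 ^ e) y) ⟩
  s (2 * (x′ + 2 ^ e * y))
    ≡⟨ s[2*x]≡s[x] (x′ + 2 ^ e * y) ⟩
  s (x′ + 2 ^ e * y)
    ≡⟨ s[x+2^e*y]≡s[x]+s[y] e x′ y (*-cancelˡ-< 2 x′ (2 ^ e) x<2^e) ⟩
  s x′ + s y
    ≡⟨ cong (_+ s y) (sym (s[2*x]≡s[x] x′)) ⟩
  s (2 * x′) + s y
    ∎
  where open ≡-Reasoning
... | odd x′ = begin
  s (1 + 2 * x′ + 2 * 2 ^ e * y)
    ≡⟨ cong s (solve 3 (λ a b c → con 1 :+ con 2 :* a :+ con 2 :* b :* c := con 1 :+ con 2 :* (a :+ b :* c)) refl x′ (2 ^ e) y) ⟩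
  s (1 + 2 * (x′ + 2 ^ e * y))
    ≡⟨ s[1+2*x]≡1+s[x] (x′ + 2 ^ e * y) ⟩
  1 + s (x′ + 2 ^ e * y)
    ≡⟨ cong suc (s[x+2^e*y]≡s[x]+s[y] e x′ y (*-cancelˡ-< 2 x′ (2 ^ e) (<-trans (n<1+n (2 * x′)) x<2^e))) ⟩
  1 + s x′ + s y
    ≡⟨ cong (_+ s y) (sym (s[1+2*x]≡1+s[x] x′)) ⟩
  s (1 + 2 * x′) + s y
    ∎
  where open ≡-Reasoning

s[1+x]≤1+s[x] : ∀ x → s (1 + x) ≤ 1 + s x
s[1+x]≤1+s[x] = binary-induction (λ x → s (1 + x) ≤ 1 + s x) ≤-refl
  (λ x _ → ≤-reflexive (trans (s[1+2*x]≡1+s[x] (suc x)) (cong suc (sym (s[2*x]≡s[x] (suc x))))))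
  (λ x ih → begin
    s (2 + 2 * x)     ≡⟨ cong s (solve 1 (λ a → con 2 :+ con 2 :* a := con 2 :* (con 1 :+ a)) refl x) ⟩
    s (2 * (1 + x))   ≡⟨ s[2*x]≡s[x] (1 + x) ⟩
    s (1 + x)         ≤⟨ ih ⟩
    1 + s x           ≡⟨ sym (s[1+2*x]≡1+s[x] x) ⟩
    s (1 + 2 * x)     ≤⟨ n≤1+n _ ⟩
    1 + s (1 + 2 * x) ∎)
  where open ≤-Reasoning

s≡0⇒≡0 : ∀ x → s x ≡ 0 → x ≡ 0
s≡0⇒≡0 = binary-induction (λ x → s x ≡ 0 → x ≡ 0) (λ _ → refl)
  (λ x ih h → ⊥-elim (1+n≢0 (ih (trans (sym (s[2*x]≡s[x] (suc x))) h))))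
  (λ x _ h → ⊥-elim (1+n≢0 (trans (sym (s[1+2*x]≡1+s[x] x)) h)))

s≡1⇒≡2^ : ∀ x → s x ≡ 1 → ∃[ v ] x ≡ 2 ^ v
s≡1⇒≡2^ = binary-induction (λ x → s x ≡ 1 → ∃[ v ] x ≡ 2 ^ v) (λ ())
  (λ x ih h → let v , e = ih (trans (sym (s[2*x]≡s[x] (suc x))) h) in suc v , cong (2 *_) e)
  (λ x _ h → 0 , cong (λ z → 1 + 2 * z) (s≡0⇒≡0 x (suc-injective (trans (sym (s[1+2*x]≡1+s[x] x)) h))))

s≡2⇒≡2^+2^ : ∀ x → s x ≡ 2 → ∃[ u ] ∃[ v ] u < v × x ≡ 2 ^ u + 2 ^ v
s≡2⇒≡2^+2^ = binary-induction (λ x → s x ≡ 2 → ∃[ u ] ∃[ v ] u < v × x ≡ 2 ^ u + 2 ^ v) (λ ())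
  (λ x ih h → let u , v , u<v , e = ih (trans (sym (s[2*x]≡s[x] (suc x))) h)
              in suc u , suc v , s≤s u<v , trans (cong (2 *_) e) (*-distribˡ-+ 2 (2 ^ u) (2 ^ v)))
  (λ x _ h → let v , e = s≡1⇒≡2^ x (suc-injective (trans (sym (s[1+2*x]≡1+s[x] x)) h))
             in 0 , suc v , s≤s z≤n , cong (λ z → 1 + 2 * z) e)

s>0⇒>0 : ∀ {x} → 0 < s x → 0 < x
s>0⇒>0 {suc x} _ = s≤s z≤n

2∤1+2*z : ∀ z → ¬ 2 ∣ 1 + 2 * z
2∤1+2*z z (divides q eq) = even≢odd q z (sym (trans eq (*-comm q 2)))

-- Each of the k lowest positions of x + y + 1 can only be cleared by a carry through a 1 of x or y.
2^k∣x+y+1⇒k≤s[x]+s[y] : ∀ k x y → 2 ^ k ∣ x + y + 1 → k ≤ s x + s y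
2^k∣x+y+1⇒k≤s[x]+s[y] zero    x y _ = z≤n
2^k∣x+y+1⇒k≤s[x]+s[y] (suc k) x y 2^[1+k]∣ with binary x | binary y
... | even a | even b = ⊥-elim (2∤1+2*z (a + b) (∣-trans (m∣m*n (2 ^ k)) (subst (2 ^ suc k ∣_)
        (solve 2 (λ a b → con 2 :* a :+ con 2 :* b :+ con 1 := con 1 :+ con 2 :* (a :+ b)) refl a b)
        2^[1+k]∣)))
... | odd a  | odd b  = ⊥-elim (2∤1+2*z (1 + a + b) (∣-trans (m∣m*n (2 ^ k)) (subst (2 ^ suc k ∣_)
        (solve 2 (λ a b → con 1 :+ con 2 :* a :+ (con 1 :+ con 2 :* b) :+ con 1
                          := con 1 :+ con 2 :* (con 1 :+ a :+ b)) refl a b)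
        2^[1+k]∣)))
... | odd a  | even b = begin
  suc k
    ≤⟨ s≤s (2^k∣x+y+1⇒k≤s[x]+s[y] k a b (*-cancelˡ-∣ 2 (subst (2 ^ suc k ∣_)
         (solve 2 (λ a b → con 1 :+ con 2 :* a :+ con 2 :* b :+ con 1 := con 2 :* (a :+ b :+ con 1)) refl a b)
         2^[1+k]∣))) ⟩
  1 + s a + s b
    ≡⟨ cong₂ _+_ (sym (s[1+2*x]≡1+s[x] a)) (sym (s[2*x]≡s[x] b)) ⟩
  s (1 + 2 * a) + s (2 * b)
    ∎
  where open ≤-Reasoning
... | even a | odd b  = begin
  suc k
    ≤⟨ s≤s (2^k∣x+y+1⇒k≤s[x]+s[y] k a b (*-cancelˡ-∣ 2 (subst (2 ^ suc k ∣_)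
         (solve 2 (λ a b → con 2 :* a :+ (con 1 :+ con 2 :* b) :+ con 1 := con 2 :* (a :+ b :+ con 1)) refl a b)
         2^[1+k]∣))) ⟩
  1 + (s a + s b)
    ≡⟨ sym (+-suc (s a) (s b)) ⟩
  s a + (1 + s b)
    ≡⟨ cong₂ _+_ (sym (s[2*x]≡s[x] a)) (sym (s[1+2*x]≡1+s[x] b)) ⟩
  s (2 * a) + s (1 + 2 * b)
    ∎
  where open ≤-Reasoning

^-monoʳ-∣ : ∀ b {m n} → m ≤ n → b ^ m ∣ b ^ n
^-monoʳ-∣ b {m} m≤n with m≤n⇒∃[o]m+o≡n m≤n
... | o , refl = divides (b ^ o) (trans (^-distribˡ-+-* b m o) (*-comm (b ^ m) (b ^ o)))

^-cancelʳ-≤ : ∀ b {m n} → 1 < b → b ^ m ≤ b ^ n → m ≤ n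
^-cancelʳ-≤ b {m} {n} 1<b b^m≤b^n with m ≤? n
... | yes m≤n = m≤n
... | no  m≰n = ⊥-elim (<⇒≱ (^-monoʳ-< b 1<b (≰⇒> m≰n)) b^m≤b^n)

*[1+2*b]≡2^⇒b≡0 : ∀ v a b → a * (1 + 2 * b) ≡ 2 ^ v → b ≡ 0
*[1+2*b]≡2^⇒b≡0 zero a b eq = m+n≡0⇒m≡0 b (suc-injective (m*n≡1⇒n≡1 a (1 + 2 * b) eq))
*[1+2*b]≡2^⇒b≡0 (suc v) a b eq with binary a
... | even a′ = *[1+2*b]≡2^⇒b≡0 v a′ b (*-cancelˡ-≡ _ _ 2 (trans (sym (*-assoc 2 a′ (1 + 2 * b))) eq))
... | odd a′  = ⊥-elim (even≢odd (2 ^ v) (a′ + b + 2 * a′ * b) (sym (trans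
        (solve 2 (λ a b → con 1 :+ con 2 :* (a :+ b :+ con 2 :* a :* b)
                          := (con 1 :+ con 2 :* a) :* (con 1 :+ con 2 :* b)) refl a′ b)
        eq)))

m≡m%n+n*[m/n] : ∀ m n .{{_ : NonZero n}} → m ≡ m % n + n * (m / n)
m≡m%n+n*[m/n] m n = trans (m≡m%n+[m/n]*n m n) (cong (m % n +_) (*-comm (m / n) n))

x+n*a≡y+n*b⇒x≡y×a≡b : ∀ n .{{_ : NonZero n}} {x y a b} → x < n → y < n →
  x + n * a ≡ y + n * b → x ≡ y × a ≡ b
x+n*a≡y+n*b⇒x≡y×a≡b n {x} {y} {a} {b} x<n y<n eq = x≡y , a≡b
  where
  open ≡-Reasoning
  x≡y : x ≡ y
  x≡y = begin
    x               ≡⟨ sym (m<n⇒m%n≡m x<n) ⟩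
    x % n           ≡⟨ sym ([m+kn]%n≡m%n x a n) ⟩
    (x + a * n) % n ≡⟨ cong (_% n) (trans (cong (x +_) (*-comm a n)) (trans eq (cong (y +_) (*-comm n b)))) ⟩
    (y + b * n) % n ≡⟨ [m+kn]%n≡m%n y b n ⟩
    y % n           ≡⟨ m<n⇒m%n≡m y<n ⟩
    y               ∎
  a≡b : a ≡ b
  a≡b = *-cancelˡ-≡ a b n (+-cancelˡ-≡ x _ _ (trans eq (cong (_+ n * b) (sym x≡y))))

1+2*m≡1+2*l+2^[1+e]*t : ∀ e m → ∃[ l ] ∃[ t ] 1 + 2 * l < 2 ^ suc e × 1 + 2 * m ≡ 1 + 2 * l + 2 ^ suc e * t
1+2*m≡1+2*l+2^[1+e]*t e m = m % E , m / E , 1+2l<2E , trans (cong (λ z → 1 + 2 * z) (m≡m%n+n*[m/n] m E))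
    (solve 3 (λ l q t → con 1 :+ con 2 :* (l :+ q :* t) := con 1 :+ con 2 :* l :+ con 2 :* q :* t) refl (m % E) E (m / E))
  where
  E : ℕ
  E = 2 ^ e
  instance
    E≢0 : NonZero E
    E≢0 = m^n≢0 2 e
  1+2l<2E : 1 + 2 * (m % E) < 2 * E
  1+2l<2E = ≤-trans (≤-reflexive (solve 1 (λ l → con 2 :+ con 2 :* l := con 2 :* (con 1 :+ l)) refl (m % E)))
                    (*-monoʳ-≤ 2 (m%n<n m E))

s[D]≡1⇒i≤s[t] : ∀ i e t → 1 ≤ t →
  s (t + (1 + 2 * 2 ^ e) * (1 + 2 * 2 ^ e) + 2 ^ (2 + i) * ((1 + 2 * 2 ^ e) * t + 2 ^ i * (t * t))) ≡ 1 →
  i ≤ s t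
s[D]≡1⇒i≤s[t] i e t t≥1 s[D]≡1 = +-cancelˡ-≤ 2 i (s t) (begin
  2 + i                                ≤⟨ 2^k∣x+y+1⇒k≤s[x]+s[y] (2 + i) t (2 ^ (2 + e) * (1 + E)) F∣t+2^[2+e]*[1+E]+1 ⟩
  s t + s (2 ^ (2 + e) * (1 + E))      ≡⟨ cong (s t +_) (s[2^e*x]≡s[x] (2 + e) (1 + E)) ⟩
  s t + s (1 + E)                      ≤⟨ +-monoʳ-≤ (s t) (≤-trans (s[1+x]≤1+s[x] E) (≤-reflexive (cong suc (s[2^e]≡1 e)))) ⟩
  s t + 2                              ≡⟨ +-comm (s t) 2 ⟩
  2 + s t                              ∎)
  where
  open ≤-Reasoning
  E : ℕ
  E = 2 ^ e
  L : ℕ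
  L = 1 + 2 * E
  F : ℕ
  F = 2 ^ (2 + i)
  Y : ℕ
  Y = L * t + 2 ^ i * (t * t)
  v : ℕ
  v = proj₁ (s≡1⇒≡2^ (t + L * L + F * Y) s[D]≡1)
  D≡2^v : t + L * L + F * Y ≡ 2 ^ v
  D≡2^v = proj₂ (s≡1⇒≡2^ (t + L * L + F * Y) s[D]≡1)
  F≤D : F ≤ t + L * L + F * Y
  F≤D = ≤-trans (≤-trans (≤-reflexive (sym (*-identityʳ F))) (*-monoʳ-≤ F (≤-trans t≥1 t≤Y))) (m≤n+m (F * Y) _)
    where
    t≤Y : t ≤ Y
    t≤Y = ≤-trans (m≤m+n t (2 * E * t)) (m≤m+n (L * t) _)
  F∣D : F ∣ t + L * L + F * Y
  F∣D = subst (F ∣_) (sym D≡2^v) (^-monoʳ-∣ 2 (^-cancelʳ-≤ 2 {2 + i} {v} ≤-refl (subst (F ≤_) D≡2^v F≤D)))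
  F∣t+2^[2+e]*[1+E]+1 : F ∣ t + 2 ^ (2 + e) * (1 + E) + 1
  F∣t+2^[2+e]*[1+E]+1 = subst (F ∣_)
    (solve 2 (λ t x → t :+ (con 1 :+ con 2 :* x) :* (con 1 :+ con 2 :* x)
                      := t :+ con 2 :* (con 2 :* x) :* (con 1 :+ x) :+ con 1) refl t E)
    (∣m+n∣m⇒∣n (subst (F ∣_) (+-comm (t + L * L) (F * Y)) F∣D) (m∣m*n Y))

1+t≡2^[1+u]+2^[2+i]*w⇒i≤2*s[t] : ∀ i u t w → u ≤ i →
  1 + t ≡ 2 ^ suc u + 2 ^ (2 + i) * w → 2 ^ i ∣ w + t → i ≤ 2 * s t
1+t≡2^[1+u]+2^[2+i]*w⇒i≤2*s[t] i u t w u≤i 1+t≡ 2^i∣w+t with binary t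
... | even x = ⊥-elim (even≢odd (2 ^ u + 2 ^ (1 + i) * w) x (trans
        (solve 3 (λ a b c → con 2 :* (a :+ b :* c) := con 2 :* a :+ con 2 :* b :* c) refl (2 ^ u) (2 ^ (1 + i)) w)
        (sym 1+t≡)))
... | odd c = begin
  i                   ≤⟨ 2^k∣x+y+1⇒k≤s[x]+s[y] i w (2 * c) 2^i∣w+2c+1 ⟩
  s w + s (2 * c)     ≡⟨ cong (s w +_) (s[2*x]≡s[x] c) ⟩
  s w + s c           ≤⟨ +-mono-≤ s[w]≤s[t] (≤-trans (n≤1+n (s c)) (≤-reflexive (sym s[t]≡1+s[c]))) ⟩
  s t + s t           ≡⟨ cong (s t +_) (sym (+-identityʳ (s t))) ⟩
  2 * s t             ∎
  where
  open ≤-Reasoning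
  2^i∣w+2c+1 : 2 ^ i ∣ w + 2 * c + 1
  2^i∣w+2c+1 = subst (2 ^ i ∣_) (trans (cong (w +_) (+-comm 1 (2 * c))) (sym (+-assoc w (2 * c) 1))) 2^i∣w+t
  s[t]≡1+s[c] : s (1 + 2 * c) ≡ 1 + s c
  s[t]≡1+s[c] = s[1+2*x]≡1+s[x] c
  2^[1+u]<2^[2+i] : 2 ^ suc u < 2 ^ (2 + i)
  2^[1+u]<2^[2+i] = ^-monoʳ-< 2 ≤-refl (s≤s (s≤s u≤i))
  s[w]≤s[t] : s w ≤ s (1 + 2 * c)
  s[w]≤s[t] = +-cancelˡ-≤ 1 (s w) _ (begin
    1 + s w                                 ≡⟨ cong (_+ s w) (sym (s[2^e]≡1 (suc u))) ⟩
    s (2 ^ suc u) + s w                     ≡⟨ sym (s[x+2^e*y]≡s[x]+s[y] (2 + i) (2 ^ suc u) w 2^[1+u]<2^[2+i]) ⟩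
    s (2 ^ suc u + 2 ^ (2 + i) * w)         ≡⟨ cong s (sym 1+t≡) ⟩
    s (1 + (1 + 2 * c))                     ≤⟨ s[1+x]≤1+s[x] (1 + 2 * c) ⟩
    1 + s (1 + 2 * c)                       ∎)

-- D ≥ 2^(2+i) (1 + 2^i) forces 2^v ≥ 2^(2+i+i); comparing both sides of D = 2^(1+u) + 2^v in base
-- 2^(2+i) then identifies the low digit of 1 + t and the high digits w + Y.
D≡2^[1+u]+2^v⇒1+t≡2^[1+u]+2^[2+i]*w : ∀ i u v t → 1 ≤ t → u ≤ i →
  (t + 1) + 2 ^ (2 + i) * (t + 2 ^ i * (t * t)) ≡ 2 ^ suc u + 2 ^ v →
  ∃[ w ] 1 + t ≡ 2 ^ suc u + 2 ^ (2 + i) * w × 2 ^ i ∣ w + t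
D≡2^[1+u]+2^v⇒1+t≡2^[1+u]+2^[2+i]*w i u v t t≥1 u≤i D≡ =
  w , subst (λ x → 1 + t ≡ x + F * w) (proj₁ digits) (m≡m%n+n*[m/n] (1 + t) F) , Q∣w+t
  where
  Q : ℕ
  Q = 2 ^ i
  F : ℕ
  F = 2 ^ (2 + i)
  U : ℕ
  U = 2 ^ suc u
  Y : ℕ
  Y = t + Q * (t * t)
  instance
    F≢0 : NonZero F
    F≢0 = m^n≢0 2 (2 + i)
  U<F : U < F
  U<F = ^-monoʳ-< 2 ≤-refl (s≤s (s≤s u≤i))
  F*Q≤2^v : F * Q ≤ 2 ^ v
  F*Q≤2^v = +-cancelˡ-≤ F (F * Q) (2 ^ v) (begin
    F + F * Q       ≡⟨ cong (_+ F * Q) (sym (*-identityʳ F)) ⟩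
    F * 1 + F * Q   ≡⟨ sym (*-distribˡ-+ F 1 Q) ⟩
    F * (1 + Q)     ≤⟨ *-monoʳ-≤ F (+-mono-≤ t≥1 Q≤Q*t*t) ⟩
    F * Y           ≤⟨ m≤n+m (F * Y) (t + 1) ⟩
    t + 1 + F * Y   ≡⟨ D≡ ⟩
    U + 2 ^ v       ≤⟨ +-monoˡ-≤ (2 ^ v) (<⇒≤ U<F) ⟩
    F + 2 ^ v       ∎)
    where
    open ≤-Reasoning
    Q≤Q*t*t : Q ≤ Q * (t * t)
    Q≤Q*t*t = ≤-trans (≤-reflexive (sym (*-identityʳ Q))) (*-monoʳ-≤ Q (*-mono-≤ t≥1 t≥1))
  F*Q≡2^[2+i+i] : F * Q ≡ 2 ^ (2 + i + i)
  F*Q≡2^[2+i+i] = sym (^-distribˡ-+-* 2 (2 + i) i)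
  F*Q∣2^v : F * Q ∣ 2 ^ v
  F*Q∣2^v = subst (_∣ 2 ^ v) (sym F*Q≡2^[2+i+i])
    (^-monoʳ-∣ 2 (^-cancelʳ-≤ 2 {2 + i + i} {v} ≤-refl (subst (_≤ 2 ^ v) F*Q≡2^[2+i+i] F*Q≤2^v)))
  c : ℕ
  c = quotient F*Q∣2^v
  w : ℕ
  w = (1 + t) / F
  digits : (1 + t) % F ≡ U × w + Y ≡ Q * c
  digits = x+n*a≡y+n*b⇒x≡y×a≡b F (m%n<n (1 + t) F) U<F (begin
    (1 + t) % F + F * (w + Y)     ≡⟨ cong ((1 + t) % F +_) (*-distribˡ-+ F w Y) ⟩
    (1 + t) % F + (F * w + F * Y) ≡⟨ sym (+-assoc ((1 + t) % F) (F * w) (F * Y)) ⟩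
    (1 + t) % F + F * w + F * Y   ≡⟨ cong (_+ F * Y) (sym (m≡m%n+n*[m/n] (1 + t) F)) ⟩
    1 + t + F * Y                 ≡⟨ cong (_+ F * Y) (+-comm 1 t) ⟩
    t + 1 + F * Y                 ≡⟨ D≡ ⟩
    U + 2 ^ v                     ≡⟨ cong (U +_) (trans (m∣n⇒n≡m*quotient F*Q∣2^v) (*-assoc F Q c)) ⟩
    U + F * (Q * c)               ∎)
    where open ≡-Reasoning
  Q∣w+t : Q ∣ w + t
  Q∣w+t = ∣m+n∣m⇒∣n (subst (Q ∣_) w+Y≡Q*t*t+[w+t] (divides c (trans (proj₂ digits) (*-comm Q c)))) (m∣m*n (t * t))
    where
    w+Y≡Q*t*t+[w+t] : w + Y ≡ Q * (t * t) + (w + t)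
    w+Y≡Q*t*t+[w+t] = solve 3 (λ w t q → w :+ (t :+ q :* (t :* t)) := q :* (t :* t) :+ (w :+ t)) refl w t Q

s[D]≡2⇒i≤2*s[t] : ∀ i t → 1 ≤ t → s (t + 1 + 2 ^ (2 + i) * (t + 2 ^ i * (t * t))) ≡ 2 → i ≤ 2 * s t
s[D]≡2⇒i≤2*s[t] i t t≥1 s[D]≡2 = by-exponents (s≡2⇒≡2^+2^ (t + 1 + F * Y) s[D]≡2)
  where
  Q : ℕ
  Q = 2 ^ i
  F : ℕ
  F = 2 ^ (2 + i)
  Y : ℕ
  Y = t + Q * (t * t)
  by-exponents : (∃[ u ] ∃[ v ] u < v × t + 1 + F * Y ≡ 2 ^ u + 2 ^ v) → i ≤ 2 * s t
  -- u = 0 would make D - 1 = t (1 + 2 (2 Q + 2 Q Q t)) a power of two with an odd factor > 1.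
  by-exponents (zero , v , _ , D≡1+2^v) = ⊥-elim (<⇒≢ (m^n>0 2 (suc i))
    (sym (m+n≡0⇒m≡0 (2 * Q) (*[1+2*b]≡2^⇒b≡0 v t (2 * Q + 2 * Q * Q * t) (suc-injective (trans
      (solve 2 (λ t q → con 1 :+ t :* (con 1 :+ con 2 :* (con 2 :* q :+ con 2 :* q :* q :* t))
                        := t :+ con 1 :+ con 2 :* (con 2 :* q) :* (t :+ q :* (t :* t))) refl t Q)
      D≡1+2^v))))))
  by-exponents (suc u , v , u<v , D≡) with 2 + i ≤? suc u
  ... | yes ℓ≤1+u = begin
    i              ≤⟨ m≤n+m i 2 ⟩
    2 + i          ≤⟨ 2^k∣x+y+1⇒k≤s[x]+s[y] (2 + i) t 0 F∣t+0+1 ⟩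
    s t + 0        ≤⟨ +-monoʳ-≤ (s t) z≤n ⟩
    2 * s t        ∎
    where
    open ≤-Reasoning
    F∣D : F ∣ t + 1 + F * Y
    F∣D = subst (F ∣_) (sym D≡) (∣m∣n⇒∣m+n (^-monoʳ-∣ 2 ℓ≤1+u) (^-monoʳ-∣ 2 (≤-trans ℓ≤1+u (<⇒≤ u<v))))
    F∣t+0+1 : F ∣ t + 0 + 1
    F∣t+0+1 = subst (F ∣_) (cong (_+ 1) (sym (+-identityʳ t)))
                (∣m+n∣m⇒∣n (subst (F ∣_) (+-comm (t + 1) (F * Y)) F∣D) (m∣m*n Y))
  ... | no ℓ≰1+u =
    let u≤i = ≤-pred (≤-pred (≰⇒> ℓ≰1+u))
        w , 1+t≡ , Q∣w+t = D≡2^[1+u]+2^v⇒1+t≡2^[1+u]+2^[2+i]*w i u v t t≥1 u≤i D≡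
    in 1+t≡2^[1+u]+2^[2+i]*w⇒i≤2*s[t] i u t w u≤i 1+t≡ Q∣w+t

s[l]+s[D]≡2⇒i≤2*[1+s[l]+s[t]] : ∀ i l t → 2 ≤ s l + s t →
  s l + s (t + (1 + 2 * l) * (1 + 2 * l) + 2 ^ (2 + i) * ((1 + 2 * l) * t + 2 ^ i * (t * t))) ≡ 2 →
  i ≤ 2 * (1 + s l + s t)
s[l]+s[D]≡2⇒i≤2*[1+s[l]+s[t]] i l t 2≤ s[l]+s[D]≡2 with s l in s[l]≡
s[l]+s[D]≡2⇒i≤2*[1+s[l]+s[t]] i l t 2≤ s[l]+s[D]≡2 | suc (suc k) =
  ⊥-elim (1+n≢0 (m+n≡0⇒n≡0 t (m+n≡0⇒m≡0 (t + _)
    (s≡0⇒≡0 _ (m+n≡0⇒n≡0 k (suc-injective (suc-injective s[l]+s[D]≡2)))))))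
s[l]+s[D]≡2⇒i≤2*[1+s[l]+s[t]] i l t 2≤ s[l]+s[D]≡2 | 1 with s≡1⇒≡2^ l s[l]≡
...   | e , refl = ≤-trans (s[D]≡1⇒i≤s[t] i e t (s>0⇒>0 (≤-pred 2≤)) (suc-injective s[l]+s[D]≡2))
                           (≤-trans (m≤n+m (s t) 2) (m≤m+n (2 + s t) _))
s[l]+s[D]≡2⇒i≤2*[1+s[l]+s[t]] i l t 2≤ s[l]+s[D]≡2 | 0 with s≡0⇒≡0 l s[l]≡
...   | refl = ≤-trans (s[D]≡2⇒i≤2*s[t] i t t≥1 (trans (cong s D≡) s[l]+s[D]≡2)) (*-monoʳ-≤ 2 (n≤1+n (s t)))
  where
  t≥1 : 1 ≤ t
  t≥1 = s>0⇒>0 (≤-trans (s≤s z≤n) 2≤)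
  D≡ : t + 1 + 2 ^ (2 + i) * (t + 2 ^ i * (t * t)) ≡ t + 1 + 2 ^ (2 + i) * (1 * t + 2 ^ i * (t * t))
  D≡ = cong (λ z → t + 1 + 2 ^ (2 + i) * (z + 2 ^ i * (t * t))) (sym (*-identityˡ t))

s[M+2^[1+i]*M*M]≡3⇒i≤2*s[M] : ∀ i m → 3 ≤ s (1 + 2 * m) →
  s (1 + 2 * m + 2 ^ (1 + i) * ((1 + 2 * m) * (1 + 2 * m))) ≡ 3 → i ≤ 2 * s (1 + 2 * m)
s[M+2^[1+i]*M*M]≡3⇒i≤2*s[M] i m 3≤s[M] s[A]≡3 with 1+2*m≡1+2*l+2^[1+e]*t i m
... | l , t , L<P , M≡ = subst (λ x → i ≤ 2 * x) (sym s[M]≡)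
        (s[l]+s[D]≡2⇒i≤2*[1+s[l]+s[t]] i l t (≤-pred (subst (3 ≤_) s[M]≡ 3≤s[M])) s[l]+s[D]≡2)
  where
  open ≡-Reasoning
  M : ℕ
  M = 1 + 2 * m
  L : ℕ
  L = 1 + 2 * l
  P : ℕ
  P = 2 ^ (1 + i)
  D : ℕ
  D = t + L * L + 2 ^ (2 + i) * (L * t + 2 ^ i * (t * t))
  s[M]≡ : s M ≡ 1 + s l + s t
  s[M]≡ = trans (cong s M≡) (trans (s[x+2^e*y]≡s[x]+s[y] (1 + i) L t L<P) (cong (_+ s t) (s[1+2*x]≡1+s[x] l)))
  A≡L+P*D : M + P * (M * M) ≡ L + P * D
  A≡L+P*D = begin
    M + P * (M * M)          ≡⟨ cong (_+ P * (M * M)) M≡ ⟩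
    L + P * t + P * (M * M)  ≡⟨ +-assoc L (P * t) (P * (M * M)) ⟩
    L + (P * t + P * (M * M)) ≡⟨ cong (L +_) (sym (*-distribˡ-+ P t (M * M))) ⟩
    L + P * (t + M * M)      ≡⟨ cong (λ x → L + P * (t + x * x)) M≡ ⟩
    L + P * (t + (L + P * t) * (L + P * t))
      ≡⟨ cong (λ x → L + P * x) (solve 3 (λ t l q → t :+ (l :+ con 2 :* q :* t) :* (l :+ con 2 :* q :* t)
                                              := t :+ l :* l :+ con 2 :* (con 2 :* q) :* (l :* t :+ q :* (t :* t))) refl t L (2 ^ i)) ⟩
    L + P * D                ∎
  s[l]+s[D]≡2 : s l + s D ≡ 2
  s[l]+s[D]≡2 = suc-injective (begin
    1 + s l + s D       ≡⟨ cong (_+ s D) (sym (s[1+2*x]≡1+s[x] l)) ⟩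
    s L + s D           ≡⟨ sym (s[x+2^e*y]≡s[x]+s[y] (1 + i) L D L<P) ⟩
    s (L + P * D)       ≡⟨ cong s (sym A≡L+P*D) ⟩
    s (M + P * (M * M)) ≡⟨ s[A]≡3 ⟩
    3                   ∎)

lemma10 : (n k ℓ m : ℕ) → s n ≡ k → k ≥ 4 → s (n * n) ≡ 4 →
    n ≡ 1 + 2 ^ ℓ * (1 + 2 * m) → ℓ ≥ 2 → ℓ ≤ 2 * k
lemma10 n k (suc (suc i)) m refl k≥4 s[n*n]≡4 refl (s≤s (s≤s z≤n)) = begin
  2 + i          ≤⟨ s≤s (s≤s (s[M+2^[1+i]*M*M]≡3⇒i≤2*s[M] i m 3≤s[M] s[A]≡3)) ⟩
  2 + 2 * s M    ≡⟨ sym (*-distribˡ-+ 2 1 (s M)) ⟩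
  2 * (1 + s M)  ≡⟨ cong (2 *_) (sym s[n]≡1+s[M]) ⟩
  2 * s n        ∎
  where
  open ≤-Reasoning
  M : ℕ
  M = 1 + 2 * m
  A : ℕ
  A = M + 2 ^ (1 + i) * (M * M)
  s[n]≡1+s[M] : s n ≡ 1 + s M
  s[n]≡1+s[M] = s[1+2^[1+e]*x]≡1+s[x] (1 + i) M
  3≤s[M] : 3 ≤ s M
  3≤s[M] = ≤-pred (subst (4 ≤_) s[n]≡1+s[M] k≥4)
  n*n≡1+2^[3+i]*A : n * n ≡ 1 + 2 ^ (3 + i) * A
  n*n≡1+2^[3+i]*A = solve 2 (λ q x → (con 1 :+ con 2 :* (con 2 :* q) :* x) :* (con 1 :+ con 2 :* (con 2 :* q) :* x)
                                  := con 1 :+ con 2 :* (con 2 :* (con 2 :* q)) :* (x :+ con 2 :* q :* (x :* x))) refl (2 ^ i) M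
  s[A]≡3 : s A ≡ 3
  s[A]≡3 = suc-injective (trans (sym (s[1+2^[1+e]*x]≡1+s[x] (2 + i) A)) (trans (cong s (sym n*n≡1+2^[3+i]*A)) s[n*n]≡4))
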